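{- Let $\sigma$ and $\tau$ be non-transitive words (of lengths $3m$ and $3n$ respectively, $m,n>0$). Then the concatenation $\sigma\tau$ (the word $\sigma$ followed by the word $\tau$) is non-transitive.
   Context: For an integer $n>0$, a word of length $3n$ is a sequence $s_1s_2\cdots s_{3n}$ of letters from $\{a,b,c\}$ in which each of $a,b,c$ occurs exactly $n$ times. For a word $\sigma=s_1\cdots s_{3n}$ define $q^+_\sigma(s_i)$ to be the number of $j<i$ with $s_j=b$ if $s_i=a$; the number of $j<i$ with $s_j=c$ if $s_i=b$; and the number of $j<i$ with $s_j=a$ if $s_i=c$. A word of length $3n$ is non-transitive if each of $\sum_{i: s_i=a} q^+_\sigma(s_i)$, $\sum_{i: s_i=b} q^+_\sigma(s_i)$, $\sum_{i: s_i=c} q^+_\sigma(s_i)$ exceeds $n^2/2$. (Equivalently, for the set of dice $(A,B,C)$ partitioning $[3n]$ with $i\in A,B,C$ according as the $i$-th letter is $a,b,c$, each of $P(A\succ B),P(B\succ C),P(C\succ A)$ exceeds $1/2$, where $P(X\succ Y)$ is the probability that an independent fair roll of $X$ exceeds one of $Y$.) -}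

module Defs where

open import Data.Nat using (ℕ; zero; suc; _+_; _*_; _<_)
open import Data.List using (List; []; _∷_; _++_)
open import Data.Product using (_×_)

data Letter : Set where
  a b c : Letter

-- The letter that x "counts": q⁺(x) counts earlier occurrences of prev x.
-- a counts b, b counts c, c counts a.
prev : Letter → Letter
prev a = b
prev b = c
prev c = a

δ : Letter → Letter → ℕ
δ a a = 1
δ b b = 1
δ c c = 1
δ _ _ = 0

count : Letter → List Letter → ℕ
count x []       = 0
count x (y ∷ ys) = δ x y + count x ys

-- scoreFrom x p w : sum, over positions i of w with w_i = x, of the number of
-- earlier letters equal to prev x, where p counts the occurrences of prev x
-- already seen before w.
scoreFrom : Letter → ℕ → List Letter → ℕ
scoreFrom x p []       = 0
scoreFrom x p (y ∷ ys) = δ x y * p + scoreFrom x (p + δ (prev x) y) ys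

score : Letter → List Letter → ℕ
score x w = scoreFrom x 0 w

-- w is a word of length 3n: each letter occurs exactly n times
-- (so the length is automatically 3n).
IsWord : ℕ → List Letter → Set
IsWord n w = (count a w ≡ n × count b w ≡ n) × count c w ≡ n
  where open import Relation.Binary.PropositionalEquality using (_≡_)

-- each score exceeds n²/2, i.e. n * n < 2 * score
NonTransitive : ℕ → List Letter → Set
NonTransitive n w =
  IsWord n w × ((n * n < 2 * score a w × n * n < 2 * score b w) × n * n < 2 * score c w)

-- Every a of τ sees all m letters b of σ, so score a (στ) =
-- score a σ + score a τ + m n, and similarly for b and c.  The cross term
-- 2 m n in 2 · score is exactly the cross term of (m + n)², so the strict
-- inequalities m² < 2 · score and n² < 2 · score add up.
module Submission where

open import Defs
open import Data.Nat using (ℕ; _+_; _*_; _<_)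
open import Data.Nat.Properties using (+-assoc; +-identityʳ; *-zeroʳ; +-mono-<; +-mono-<-≤; ≤-refl)
open import Data.Nat.Tactic.RingSolver using (solve-∀)
open import Data.List using (List; []; _∷_; _++_)
open import Data.Product using (_,_)
open import Relation.Binary.PropositionalEquality
  using (_≡_; refl; sym; trans; cong; cong₂; subst; subst₂; module ≡-Reasoning)

count-++ : ∀ x σ τ → count x (σ ++ τ) ≡ count x σ + count x τ
count-++ x []      τ = refl
count-++ x (y ∷ σ) τ = trans (cong (δ x y +_) (count-++ x σ τ)) (sym (+-assoc (δ x y) _ _))

IsWord-++ : ∀ {m n} σ τ → IsWord m σ → IsWord n τ → IsWord (m + n) (σ ++ τ)
IsWord-++ σ τ ((σa , σb) , σc) ((τa , τb) , τc) =
  (add a σa τa , add b σb τb) , add c σc τc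
  where
  add : ∀ x {m n} → count x σ ≡ m → count x τ ≡ n → count x (σ ++ τ) ≡ m + n
  add x eσ eτ = trans (count-++ x σ τ) (cong₂ _+_ eσ eτ)

scoreFrom-shift : ∀ x p k w → scoreFrom x (p + k) w ≡ scoreFrom x p w + k * count x w
scoreFrom-shift x p k []      = sym (*-zeroʳ k)
scoreFrom-shift x p k (y ∷ w) = begin
  δ x y * (p + k) + scoreFrom x (p + k + d) w
    ≡⟨ cong (λ q → δ x y * (p + k) + scoreFrom x q w) (commute p k d) ⟩
  δ x y * (p + k) + scoreFrom x (p + d + k) w
    ≡⟨ cong (δ x y * (p + k) +_) (scoreFrom-shift x (p + d) k w) ⟩
  δ x y * (p + k) + (scoreFrom x (p + d) w + k * count x w)
    ≡⟨ regroup (δ x y) p k (scoreFrom x (p + d) w) (count x w) ⟩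
  δ x y * p + scoreFrom x (p + d) w + k * (δ x y + count x w)
    ∎
  where
  open ≡-Reasoning
  d = δ (prev x) y
  commute : ∀ p k d → p + k + d ≡ p + d + k
  commute = solve-∀
  regroup : ∀ e p k s n → e * (p + k) + (s + k * n) ≡ e * p + s + k * (e + n)
  regroup = solve-∀

scoreFrom-++ : ∀ x p σ τ →
  scoreFrom x p (σ ++ τ) ≡ scoreFrom x p σ + scoreFrom x (p + count (prev x) σ) τ
scoreFrom-++ x p []      τ = cong (λ q → scoreFrom x q τ) (sym (+-identityʳ p))
scoreFrom-++ x p (y ∷ σ) τ = begin
  δ x y * p + scoreFrom x (p + d) (σ ++ τ)
    ≡⟨ cong (δ x y * p +_) (scoreFrom-++ x (p + d) σ τ) ⟩
  δ x y * p + (scoreFrom x (p + d) σ + scoreFrom x (p + d + count (prev x) σ) τ)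
    ≡⟨ sym (+-assoc (δ x y * p) _ _) ⟩
  δ x y * p + scoreFrom x (p + d) σ + scoreFrom x (p + d + count (prev x) σ) τ
    ≡⟨ cong (λ q → δ x y * p + scoreFrom x (p + d) σ + scoreFrom x q τ) (+-assoc p d _) ⟩
  δ x y * p + scoreFrom x (p + d) σ + scoreFrom x (p + (d + count (prev x) σ)) τ
    ∎
  where
  open ≡-Reasoning
  d = δ (prev x) y

score-++ : ∀ x σ τ → score x (σ ++ τ) ≡ score x σ + score x τ + count (prev x) σ * count x τ
score-++ x σ τ = begin
  score x (σ ++ τ)
    ≡⟨ scoreFrom-++ x 0 σ τ ⟩
  score x σ + scoreFrom x (0 + count (prev x) σ) τ
    ≡⟨ cong (score x σ +_) (scoreFrom-shift x 0 (count (prev x) σ) τ) ⟩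
  score x σ + (score x τ + count (prev x) σ * count x τ)
    ≡⟨ sym (+-assoc (score x σ) _ _) ⟩
  score x σ + score x τ + count (prev x) σ * count x τ
    ∎
  where open ≡-Reasoning

square-sum-<-double : ∀ m n A B → m * m < 2 * A → n * n < 2 * B →
  (m + n) * (m + n) < 2 * (A + B + m * n)
square-sum-<-double m n A B m²<2A n²<2B =
  subst₂ _<_ (sym (square m n)) (sym (double A B m n))
    (+-mono-<-≤ (+-mono-< m²<2A n²<2B) (≤-refl {2 * (m * n)}))
  where
  square : ∀ m n → (m + n) * (m + n) ≡ m * m + n * n + 2 * (m * n)
  square = solve-∀
  double : ∀ A B m n → 2 * (A + B + m * n) ≡ 2 * A + 2 * B + 2 * (m * n)
  double = solve-∀

score-++-exceeds : ∀ x {m n} σ τ → count (prev x) σ ≡ m → count x τ ≡ n →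
  m * m < 2 * score x σ → n * n < 2 * score x τ → (m + n) * (m + n) < 2 * score x (σ ++ τ)
score-++-exceeds x {m} {n} σ τ refl refl σ-exceeds τ-exceeds =
  subst (λ s → (m + n) * (m + n) < 2 * s) (sym (score-++ x σ τ))
    (square-sum-<-double m n (score x σ) (score x τ) σ-exceeds τ-exceeds)

lemma2p5 : (m n : ℕ) → 0 < m → 0 < n → (σ τ : List Letter) →
    NonTransitive m σ → NonTransitive n τ → NonTransitive (m + n) (σ ++ τ)
lemma2p5 m n _ _ σ τ (σ-word@((σa , σb) , σc) , ((σ-a , σ-b) , σ-c))
                     (τ-word@((τa , τb) , τc) , ((τ-a , τ-b) , τ-c)) =
  IsWord-++ σ τ σ-word τ-word ,
  ( ( score-++-exceeds a σ τ σb τa σ-a τ-a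
    , score-++-exceeds b σ τ σc τb σ-b τ-b )
  , score-++-exceeds c σ τ σa τc σ-c τ-c )
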